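{- For all $n\geq 1$, $$B_{n}^{neobc}=\frac{21B_{2n-1}-3B_{2n-2}+3}{4},\quad C_{n}^{neobc}=15B_{2n-1}-3B_{2n-2},$$ $$R_{n}^{neobc}=\frac{9B_{2n-1}-3B_{2n-2}-5}{4},\quad CR_{n}^{neobc}=3B_{2n-1}.$$
   Context: Balancing numbers: $B_0=0$, $B_1=1$, $B_k=6B_{k-1}-B_{k-2}$ for $k\geq2$. A positive integer $m$ is a neo balcobalancing number if there is a positive integer $r$ (its neo balcobalancer) such that $(1+2+\cdots+(m-1))+(1+2+\cdots+m)=2[(m-1)+m+(m+1)+(m+2)+\cdots+(m+r)]$; then $r=\frac{ -2m-1+\sqrt{8m^2-12m+9}}{2}$ (equivalently, $m$ is a neo balcobalancing number iff $8m^2-12m+9$ is a perfect square). $B_n^{neobc}$ denotes the $n$-th neo balcobalancing number in increasing order ($n\ge1$), $R_n^{neobc}$ its neo balcobalancer, $C_n^{neobc}=\sqrt{8(B_n^{neobc})^2-12B_n^{neobc}+9}$ (neo Lucas-balcobalancing number) and $CR_n^{neobc}=\sqrt{2(R_n^{neobc})^2+5R_n^{neobc}+2}$ (neo Lucas-balcobalancer). -}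

module Defs where

open import Data.Nat using (ℕ; zero; suc; _+_; _*_; _∸_; _≤_; _<_)
open import Data.Product using (Σ; _×_)
open import Relation.Binary.PropositionalEquality using (_≡_)
open import Relation.Nullary using (¬_)

-- Balancing numbers: B 0 = 0, B 1 = 1, B (k+2) = 6 B (k+1) - B k.
-- (The sequence is increasing, so truncated subtraction is exact here.)
B : ℕ → ℕ
B zero = 0
B (suc zero) = 1
B (suc (suc k)) = 6 * B (suc k) ∸ B k

sumTo : ℕ → ℕ
sumTo zero = 0
sumTo (suc k) = sumTo k + suc k

sumFrom : ℕ → ℕ → ℕ
sumFrom a zero = 0
sumFrom a (suc len) = a + sumFrom (suc a) len

-- r is a neo balcobalancer of m (both positive):
-- (1+...+(m-1)) + (1+...+m) = 2[(m-1)+m+(m+1)+...+(m+r)]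
-- the right-hand bracket has r+2 terms starting at m-1.
NeoBalcobalancer : ℕ → ℕ → Set
NeoBalcobalancer m r =
  1 ≤ m × 1 ≤ r × (sumTo (m ∸ 1) + sumTo m ≡ 2 * sumFrom (m ∸ 1) (r + 2))

IsNeoBalcobalancing : ℕ → Set
IsNeoBalcobalancing m = Σ ℕ (λ r → NeoBalcobalancer m r)

data NthElem (P : ℕ → Set) : ℕ → ℕ → Set where
  first : ∀ {m} → P m → (∀ k → k < m → ¬ P k) → NthElem P 1 m
  next  : ∀ {n m' m} → NthElem P n m' → m' < m → P m →
          (∀ k → m' < k → k < m → ¬ P k) → NthElem P (suc n) m

NthNeoBalcobalancing : ℕ → ℕ → Set
NthNeoBalcobalancing n m = NthElem IsNeoBalcobalancing n m

-- Writing m = 2 + r + x, the defining identity of a neo balcobalancer r of m becomes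
-- x² = 2r² + 5r + 2 (so x is the neo Lucas-balcobalancer CR), i.e. the Pell-type equation
-- y² = 8x² + 9 with y = 4r + 5.  Every solution in ℕ arises from (3, 0) by the step
-- (y, x) ↦ (3y + 8x, y + 3x): for x ≥ 3 the inverse step stays in ℕ and decreases x, and
-- x = 1, 2 give no solution.  The k-th solution is (3 C_k, 3 B_k) with C_k the Lucas-balancing
-- numbers, and y ≡ 1 (mod 4) holds exactly for odd k.  Hence the n-th neo balcobalancing
-- number comes from k = 2n - 1: CR = 3 B_{2n-1}, 4r + 5 = 9 B_{2n-1} - 3 B_{2n-2}, and
-- C = 2m + 2r + 1 = 15 B_{2n-1} - 3 B_{2n-2}.
module Submission where

open import Defs
open import Data.Nat using (ℕ; zero; suc; _+_; _*_; _∸_; _≤_; _<_; _%_; z≤n; s≤s; z<s)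
open import Data.Nat.Properties
open import Data.Nat.DivMod using ([m+kn]%n≡m%n)
open import Data.Nat.Induction using (<-rec)
open import Data.Nat.Tactic.RingSolver using (solve-∀; solve)
open import Data.List using ([]; _∷_)
open import Data.Product using (Σ; ∃; _×_; _,_; proj₁; proj₂; map)
open import Data.Product.Properties using (,-injectiveˡ; ,-injectiveʳ)
open import Data.Sum using (inj₁; inj₂)
open import Function using (_∘_; case_of_)
open import Function.Bundles using (_⇔_; mk⇔; module Equivalence)
open import Relation.Nullary using (¬_; contradiction)
open import Relation.Binary.PropositionalEquality

open Equivalence using (to; from)

cancelʳ-by : ∀ {a b c d} → a + b ≡ c + d → b ≡ d → a ≡ c
cancelʳ-by {a} {b} {c} eq b≡d = +-cancelʳ-≡ b a c (trans eq (cong (c +_) (sym b≡d)))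

cancelˡ-by : ∀ {a b c d} → a + b ≡ c + d → a ≡ c → b ≡ d
cancelˡ-by {a} {b} {c} eq a≡c = +-cancelˡ-≡ c _ _ (trans (cong (_+ b) (sym a≡c)) eq)

square-reflect-≤ : ∀ {a b} → a * a ≤ b * b → a ≤ b
square-reflect-≤ sq = ≮⇒≥ (λ b<a → <⇒≱ (*-mono-< b<a b<a) sq)

square-reflect-< : ∀ {a b} → a * a < b * b → a < b
square-reflect-< sq = ≰⇒> (λ b≤a → <⇒≱ sq (*-mono-≤ b≤a b≤a))

square-injective : ∀ {a b} → a * a ≡ b * b → a ≡ b
square-injective eq =
  ≤-antisym (square-reflect-≤ (≤-reflexive eq)) (square-reflect-≤ (≤-reflexive (sym eq)))

square-between-consecutive : ∀ {a c} y → a * a < c → c < suc a * suc a → y * y ≢ c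
square-between-consecutive {a} y lo hi refl =
  <⇒≱ (square-reflect-< {y} {suc a} hi) (square-reflect-< {a} {y} lo)

nthElem-enumeration : ∀ {P : ℕ → Set} (f : ℕ → ℕ) → (∀ j → f j < f (suc j)) →
  (∀ j → P (f j)) → (∀ k → P k → ∃ λ j → k ≡ f j) → ∀ j → NthElem P (suc j) (f j)
nthElem-enumeration {P} f increasing inRange complete = nth
  where
  mono : ∀ {i j} → i ≤ j → f i ≤ f j
  mono {j = zero} z≤n = ≤-refl
  mono {j = suc j} i≤1+j with m≤n⇒m<n∨m≡n i≤1+j
  ... | inj₁ i<1+j = ≤-trans (mono (≤-pred i<1+j)) (<⇒≤ (increasing j))
  ... | inj₂ refl = ≤-refl
  below-first : ∀ k → k < f 0 → ¬ P k
  below-first k k<f0 pk with complete k pk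
  ... | i , refl = <⇒≱ k<f0 (mono z≤n)
  between : ∀ j k → f j < k → k < f (suc j) → ¬ P k
  between j k fj<k k<fj+1 pk with complete k pk
  ... | i , refl with ≤-<-connex i j
  ...   | inj₁ i≤j = <⇒≱ fj<k (mono i≤j)
  ...   | inj₂ j<i = <⇒≱ k<fj+1 (mono j<i)
  nth : ∀ j → NthElem P (suc j) (f j)
  nth zero = first (inRange 0) below-first
  nth (suc j) = next (nth j) (increasing j) (inRange (suc j)) (between j)

B-mono : ∀ k → B k ≤ B (suc k)
B-recurrence : ∀ k → B (2 + k) + B k ≡ 6 * B (suc k)

B-recurrence k = m∸n+n≡m (≤-trans (B-mono k) (m≤n*m (B (suc k)) 6))

B-mono zero = z≤n
B-mono (suc k) = ≤-trans (m≤n*m (B (suc k)) 5) (+-cancelʳ-≤ (B (suc k)) _ _ (begin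
  5 * B (suc k) + B (suc k)   ≡⟨ +-comm (5 * B (suc k)) (B (suc k)) ⟩
  6 * B (suc k)               ≡⟨ B-recurrence k ⟨
  B (2 + k) + B k             ≤⟨ +-monoʳ-≤ (B (2 + k)) (B-mono k) ⟩
  B (2 + k) + B (suc k)       ∎))
  where open ≤-Reasoning

sumTo-consecutive : ∀ p → sumTo p + sumTo (suc p) ≡ suc p * suc p
sumTo-consecutive zero = refl
sumTo-consecutive (suc p) = cancelʳ-by (identity (sumTo p) p) (sym (sumTo-consecutive p))
  where
  identity : ∀ s p → (s + suc p) + ((s + suc p) + suc (suc p)) + suc p * suc p
                   ≡ suc (suc p) * suc (suc p) + (s + (s + suc p))
  identity = solve-∀

sumFrom-closed : ∀ a len → 2 * sumFrom a len + len ≡ len * (2 * a + len)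
sumFrom-closed a zero = refl
sumFrom-closed a (suc len) =
  cancelʳ-by (identity a (sumFrom (suc a) len) len) (sym (sumFrom-closed (suc a) len))
  where
  identity : ∀ a s len → 2 * (a + s) + suc len + len * (2 * suc a + len)
                       ≡ suc len * (2 * a + suc len) + (2 * s + len)
  identity = solve-∀

BalanceEq : ℕ → ℕ → Set
BalanceEq m r = m * m + (2 + r) ≡ (2 + r) * (2 * m + r)

sums⇔balanceEq : ∀ p r → (sumTo p + sumTo (suc p) ≡ 2 * sumFrom p (r + 2)) ⇔ BalanceEq (suc p) r
sums⇔balanceEq p r = mk⇔ to′ from′
  where
  open ≡-Reasoning
  rhs : 2 * sumFrom p (r + 2) + (r + 2) ≡ (2 + r) * (2 * suc p + r)
  rhs = trans (sumFrom-closed p (r + 2)) (solve (p ∷ r ∷ []))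
  to′ : sumTo p + sumTo (suc p) ≡ 2 * sumFrom p (r + 2) → BalanceEq (suc p) r
  to′ eq = begin
    suc p * suc p + (2 + r)             ≡⟨ cong (_+ (2 + r)) (sym (sumTo-consecutive p)) ⟩
    sumTo p + sumTo (suc p) + (2 + r)   ≡⟨ cong₂ _+_ eq (+-comm 2 r) ⟩
    2 * sumFrom p (r + 2) + (r + 2)     ≡⟨ rhs ⟩
    (2 + r) * (2 * suc p + r)           ∎
  from′ : BalanceEq (suc p) r → sumTo p + sumTo (suc p) ≡ 2 * sumFrom p (r + 2)
  from′ eq = +-cancelʳ-≡ (r + 2) _ _ (begin
    sumTo p + sumTo (suc p) + (r + 2)   ≡⟨ cong₂ _+_ (sumTo-consecutive p) (+-comm r 2) ⟩
    suc p * suc p + (2 + r)             ≡⟨ eq ⟩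
    (2 + r) * (2 * suc p + r)           ≡⟨ rhs ⟨
    2 * sumFrom p (r + 2) + (r + 2)     ∎)

balanceEq⇒2+r≤m : ∀ m r → 1 ≤ m → 1 ≤ r → BalanceEq m r → 2 + r ≤ m
balanceEq⇒2+r≤m m r 1≤m 1≤r eq = ≮⇒≥ (λ m<2+r → <⇒≢ (lhs<rhs m<2+r) eq)
  where
  open ≤-Reasoning
  lhs<rhs : m < 2 + r → m * m + (2 + r) < (2 + r) * (2 * m + r)
  lhs<rhs m<2+r = begin-strict
    m * m + (2 + r)         ≤⟨ +-monoˡ-≤ (2 + r) (*-monoˡ-≤ m (<⇒≤ m<2+r)) ⟩
    (2 + r) * m + (2 + r)   ≡⟨ solve (m ∷ r ∷ []) ⟩
    (2 + r) * (1 + m)       <⟨ *-monoʳ-< (2 + r) (+-monoˡ-< m (+-mono-≤ 1≤m 1≤r)) ⟩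
    (2 + r) * (m + r + m)   ≡⟨ solve (m ∷ r ∷ []) ⟩
    (2 + r) * (2 * m + r)   ∎

balanceEq⇔CR : ∀ r x → BalanceEq (2 + r + x) r ⇔ x * x ≡ 2 * r * r + 5 * r + 2
balanceEq⇔CR r x = mk⇔
  (λ eq → cancelʳ-by (identity r x) (sym eq))
  (λ eq → sym (cancelˡ-by (identity r x) eq))
  where
  identity : ∀ r x → x * x + (2 + r) * (2 * (2 + r + x) + r)
                   ≡ 2 * r * r + 5 * r + 2 + ((2 + r + x) * (2 + r + x) + (2 + r))
  identity = solve-∀

balanceEq⇒lucas : ∀ m r → BalanceEq m r →
  (2 * m + 2 * r + 1) * (2 * m + 2 * r + 1) + 12 * m ≡ 8 * m * m + 9
balanceEq⇒lucas m r eq = cancelʳ-by (identity m r) (cong (4 *_) eq)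
  where
  identity : ∀ m r → (2 * m + 2 * r + 1) * (2 * m + 2 * r + 1) + 12 * m + 4 * (m * m + (2 + r))
                   ≡ 8 * m * m + 9 + 4 * ((2 + r) * (2 * m + r))
  identity = solve-∀

IsPell : ℕ × ℕ → Set
IsPell (y , x) = y * y ≡ 8 * (x * x) + 9

CR⇔pell : ∀ r x → x * x ≡ 2 * r * r + 5 * r + 2 ⇔ IsPell (4 * r + 5 , x)
CR⇔pell r x = mk⇔
  (λ eq → trans (identity r) (cong (λ t → 8 * t + 9) (sym eq)))
  (λ eq → *-cancelˡ-≡ _ _ 8 (+-cancelʳ-≡ 9 _ _ (trans (sym eq) (identity r))))
  where
  identity : ∀ r → (4 * r + 5) * (4 * r + 5) ≡ 8 * (2 * r * r + 5 * r + 2) + 9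
  identity = solve-∀

pellStep : ℕ × ℕ → ℕ × ℕ
pellStep (y , x) = 3 * y + 8 * x , y + 3 * x

pell : ℕ → ℕ × ℕ
pell zero = 3 , 0
pell (suc k) = pellStep (pell k)

pellStep-invariant : ∀ p → IsPell (pellStep p) ⇔ IsPell p
pellStep-invariant (y , x) = mk⇔
  (λ eq → cancelʳ-by (identity y x) (sym eq))
  (λ eq → sym (cancelˡ-by (identity y x) eq))
  where
  identity : ∀ y x → y * y + (8 * ((y + 3 * x) * (y + 3 * x)) + 9)
                   ≡ 8 * (x * x) + 9 + (3 * y + 8 * x) * (3 * y + 8 * x)
  identity = solve-∀

pell-isPell : ∀ k → IsPell (pell k)
pell-isPell zero = refl
pell-isPell (suc k) = from (pellStep-invariant (pell k)) (pell-isPell k)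

pell-lowerBounds : ∀ y x → IsPell (y , x) → 8 * x ≤ 3 * y × 2 * x < y
pell-lowerBounds y x eq = square-reflect-≤ 64x²≤9y² , square-reflect-< 4x²<y²
  where
  open ≤-Reasoning
  64x²≤9y² : (8 * x) * (8 * x) ≤ (3 * y) * (3 * y)
  64x²≤9y² = begin
    (8 * x) * (8 * x)                        ≤⟨ m≤m+n _ _ ⟩
    (8 * x) * (8 * x) + (8 * (x * x) + 81)   ≡⟨ solve (x ∷ []) ⟩
    9 * (8 * (x * x) + 9)                    ≡⟨ cong (9 *_) eq ⟨
    9 * (y * y)                              ≡⟨ solve (y ∷ []) ⟩
    (3 * y) * (3 * y)                        ∎
  4x²<y² : (2 * x) * (2 * x) < y * y
  4x²<y² = begin-strict
    (2 * x) * (2 * x)                        <⟨ m<m+n _ z<s ⟩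
    (2 * x) * (2 * x) + (9 + 4 * (x * x))    ≡⟨ solve (x ∷ []) ⟩
    8 * (x * x) + 9                          ≡⟨ eq ⟨
    y * y                                    ∎

pell-upperBound : ∀ y x → 3 ≤ x → IsPell (y , x) → y ≤ 3 * x
pell-upperBound y x 3≤x eq = square-reflect-≤ (begin
  y * y                 ≡⟨ eq ⟩
  8 * (x * x) + 9       ≤⟨ +-monoʳ-≤ (8 * (x * x)) (*-mono-≤ 3≤x 3≤x) ⟩
  8 * (x * x) + x * x   ≡⟨ solve (x ∷ []) ⟩
  (3 * x) * (3 * x)     ∎)
  where open ≤-Reasoning

pell-descent : ∀ y x → 3 ≤ x → IsPell (y , x) → ∃ λ p → pellStep p ≡ (y , x) × proj₂ p < x
pell-descent y x 3≤x eq = (y₀ , x₀) , cong₂ _,_ y-back x-back , x₀<x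
  where
  y₀ = 3 * y ∸ 8 * x
  x₀ = 3 * x ∸ y
  8x+y₀≡3y : 8 * x + y₀ ≡ 3 * y
  8x+y₀≡3y = m+[n∸m]≡n (proj₁ (pell-lowerBounds y x eq))
  y+x₀≡3x : y + x₀ ≡ 3 * x
  y+x₀≡3x = m+[n∸m]≡n (pell-upperBound y x 3≤x eq)
  identityʸ : ∀ y x y₀ x₀ → 3 * y₀ + 8 * x₀ + (3 * (3 * y) + 8 * (3 * x))
                          ≡ y + (3 * (8 * x + y₀) + 8 * (y + x₀))
  identityʸ = solve-∀
  identityˣ : ∀ y x y₀ x₀ → y₀ + 3 * x₀ + (3 * y + 3 * (3 * x))
                          ≡ x + ((8 * x + y₀) + 3 * (y + x₀))
  identityˣ = solve-∀
  y-back : 3 * y₀ + 8 * x₀ ≡ y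
  y-back = cancelʳ-by (identityʸ y x y₀ x₀)
    (cong₂ (λ u v → 3 * u + 8 * v) (sym 8x+y₀≡3y) (sym y+x₀≡3x))
  x-back : y₀ + 3 * x₀ ≡ x
  x-back = cancelʳ-by (identityˣ y x y₀ x₀)
    (cong₂ (λ u v → u + 3 * v) (sym 8x+y₀≡3y) (sym y+x₀≡3x))
  x₀<x : x₀ < x
  x₀<x = +-cancelʳ-< (2 * x) x₀ x (begin-strict
    x₀ + 2 * x   <⟨ +-monoʳ-< x₀ (proj₂ (pell-lowerBounds y x eq)) ⟩
    x₀ + y       ≡⟨ +-comm x₀ y ⟩
    y + x₀       ≡⟨ y+x₀≡3x ⟩
    3 * x        ≡⟨ solve (x ∷ []) ⟩
    x + 2 * x    ∎)
    where open ≤-Reasoning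

pell-complete : ∀ p → IsPell p → ∃ λ k → pell k ≡ p
pell-complete (y , x) = <-rec _ complete x y
  where
  complete : ∀ x → (∀ {x₀} → x₀ < x → ∀ y₀ → IsPell (y₀ , x₀) → ∃ λ k → pell k ≡ (y₀ , x₀)) →
             ∀ y → IsPell (y , x) → ∃ λ k → pell k ≡ (y , x)
  complete 0 _ y eq = 0 , cong (_, 0) (square-injective {3} {y} (sym eq))
  complete 1 _ y eq = contradiction eq (square-between-consecutive {4} y ≤-refl (m≤m+n 18 7))
  complete 2 _ y eq = contradiction eq (square-between-consecutive {6} y (m≤m+n 37 4) (m≤m+n 42 7))
  complete x@(suc (suc (suc _))) smaller y eq =
    suc (proj₁ earlier) , trans (cong pellStep (proj₂ earlier)) step≡
    where
    descent = pell-descent y x (s≤s (s≤s (s≤s z≤n))) eq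
    p₀ = proj₁ descent
    step≡ : pellStep p₀ ≡ (y , x)
    step≡ = proj₁ (proj₂ descent)
    earlier : ∃ λ k → pell k ≡ p₀
    earlier = smaller (proj₂ (proj₂ descent)) (proj₁ p₀)
                (to (pellStep-invariant p₀) (subst IsPell (sym step≡) eq))

pell-y-mod4 : ∀ k → proj₁ (pell (2 + k)) % 4 ≡ proj₁ (pell k) % 4
pell-y-mod4 k = trans (cong (_% 4) (identity y x)) ([m+kn]%n≡m%n y (4 * y + 12 * x) 4)
  where
  y = proj₁ (pell k)
  x = proj₂ (pell k)
  identity : ∀ y x → 3 * (3 * y + 8 * x) + 8 * (y + 3 * x) ≡ y + (4 * y + 12 * x) * 4
  identity = solve-∀

pell-y≡1mod4⇒odd : ∀ k → proj₁ (pell k) % 4 ≡ 1 → ∃ λ j → k ≡ suc (2 * j)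
pell-y≡1mod4⇒odd 0 ()
pell-y≡1mod4⇒odd 1 _ = 0 , refl
pell-y≡1mod4⇒odd (suc (suc k)) y≡1 =
  map suc (λ {j} k≡ → trans (cong (2 +_) k≡) (cong suc (sym (*-suc 2 j))))
    (pell-y≡1mod4⇒odd k (trans (sym (pell-y-mod4 k)) y≡1))

4r+5≡1mod4 : ∀ r → (4 * r + 5) % 4 ≡ 1
4r+5≡1mod4 r = trans (cong (_% 4) (identity r)) ([m+kn]%n≡m%n 1 (r + 1) 4)
  where
  identity : ∀ r → 4 * r + 5 ≡ 1 + (r + 1) * 4
  identity = solve-∀

pellStep-balancing : ∀ y x b₀ b₁ b₂ → b₂ + b₀ ≡ 6 * b₁ → y + 3 * b₀ ≡ 9 * b₁ → x ≡ 3 * b₁ →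
  (3 * y + 8 * x) + 3 * b₁ ≡ 9 * b₂ × y + 3 * x ≡ 3 * b₂
pellStep-balancing y _ b₀ b₁ b₂ rec y-eq refl =
  cancelʳ-by (identityʸ y b₀ b₁ b₂) (cong₂ (λ u v → 3 * u + 9 * v) (sym y-eq) rec) ,
  cancelʳ-by (identityˣ y b₀ b₁ b₂) (cong₂ (λ u v → u + 3 * v) (sym y-eq) rec)
  where
  identityʸ : ∀ y b₀ b₁ b₂ → 3 * y + 8 * (3 * b₁) + 3 * b₁ + (3 * (9 * b₁) + 9 * (b₂ + b₀))
                           ≡ 9 * b₂ + (3 * (y + 3 * b₀) + 9 * (6 * b₁))
  identityʸ = solve-∀
  identityˣ : ∀ y b₀ b₁ b₂ → y + 3 * (3 * b₁) + (9 * b₁ + 3 * (b₂ + b₀))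
                           ≡ 3 * b₂ + ((y + 3 * b₀) + 3 * (6 * b₁))
  identityˣ = solve-∀

pell-balancing : ∀ k →
  proj₁ (pell (suc k)) + 3 * B k ≡ 9 * B (suc k) × proj₂ (pell (suc k)) ≡ 3 * B (suc k)
pell-balancing zero = refl , refl
pell-balancing (suc k) =
  pellStep-balancing (proj₁ (pell (suc k))) (proj₂ (pell (suc k))) (B k) (B (suc k)) (B (2 + k))
    (B-recurrence k) (proj₁ (pell-balancing k)) (proj₂ (pell-balancing k))

-- neoPair j = (R, CR) of the (j + 1)-st neo balcobalancing number: two Pell steps
-- (y, x) ↦ (17 y + 48 x, 6 y + 17 x), rewritten for y = 4 R + 5 and x = CR.
neoPair : ℕ → ℕ × ℕ
neoPair zero = 1 , 3
neoPair (suc j) = let (r , x) = neoPair j in 20 + 17 * r + 12 * x , 30 + 24 * r + 17 * x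

neoR neoCR neoB : ℕ → ℕ
neoR j = proj₁ (neoPair j)
neoCR j = proj₂ (neoPair j)
neoB j = 2 + neoR j + neoCR j

neoR-positive : ∀ j → 1 ≤ neoR j
neoR-positive zero = s≤s z≤n
neoR-positive (suc j) = s≤s z≤n

pellStep²-neo : ∀ r x →
  pellStep (pellStep (4 * r + 5 , x)) ≡ (4 * (20 + 17 * r + 12 * x) + 5 , 30 + 24 * r + 17 * x)
pellStep²-neo r x = cong₂ _,_ (identityʸ r x) (identityˣ r x)
  where
  identityʸ : ∀ r x → 3 * (3 * (4 * r + 5) + 8 * x) + 8 * ((4 * r + 5) + 3 * x)
                    ≡ 4 * (20 + 17 * r + 12 * x) + 5
  identityʸ = solve-∀
  identityˣ : ∀ r x → (3 * (4 * r + 5) + 8 * x) + 3 * ((4 * r + 5) + 3 * x)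
                    ≡ 30 + 24 * r + 17 * x
  identityˣ = solve-∀

pell-odd : ∀ j → pell (suc (2 * j)) ≡ (4 * neoR j + 5 , neoCR j)
pell-odd zero = refl
pell-odd (suc j) = begin
  pell (suc (2 * suc j))                           ≡⟨ cong (pell ∘ suc) (*-suc 2 j) ⟩
  pellStep (pellStep (pell (suc (2 * j))))         ≡⟨ cong (pellStep ∘ pellStep) (pell-odd j) ⟩
  pellStep (pellStep (4 * neoR j + 5 , neoCR j))   ≡⟨ pellStep²-neo (neoR j) (neoCR j) ⟩
  (4 * neoR (suc j) + 5 , neoCR (suc j))           ∎
  where open ≡-Reasoning

neoB-balanceEq : ∀ j → BalanceEq (neoB j) (neoR j)
neoB-balanceEq j = from (balanceEq⇔CR (neoR j) (neoCR j))
  (from (CR⇔pell (neoR j) (neoCR j)) (subst IsPell (pell-odd j) (pell-isPell (suc (2 * j)))))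

neoB-neoBalcobalancer : ∀ j → NeoBalcobalancer (neoB j) (neoR j)
neoB-neoBalcobalancer j =
  s≤s z≤n , neoR-positive j , from (sums⇔balanceEq _ (neoR j)) (neoB-balanceEq j)

neoB-increasing : ∀ j → neoB j < neoB (suc j)
neoB-increasing j = begin-strict
  neoB j                                           <⟨ m<m+n (neoB j) z<s ⟩
  neoB j + suc (49 + 40 * neoR j + 28 * neoCR j)   ≡⟨ identity (neoR j) (neoCR j) ⟩
  neoB (suc j)                                     ∎
  where
  open ≤-Reasoning
  identity : ∀ r x → 2 + r + x + suc (49 + 40 * r + 28 * x)
                   ≡ 2 + (20 + 17 * r + 12 * x) + (30 + 24 * r + 17 * x)
  identity = solve-∀

neoBalcobalancer⇒CR : ∀ {m r} → NeoBalcobalancer m r →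
  ∃ λ x → 2 + r + x ≡ m × x * x ≡ 2 * r * r + 5 * r + 2
neoBalcobalancer⇒CR {suc p} {r} (_ , 1≤r , sums) =
  suc p ∸ (2 + r) , m≡ , to (balanceEq⇔CR r _) (subst (λ m → BalanceEq m r) (sym m≡) balance)
  where
  balance : BalanceEq (suc p) r
  balance = to (sums⇔balanceEq p r) sums
  m≡ : 2 + r + (suc p ∸ (2 + r)) ≡ suc p
  m≡ = m+[n∸m]≡n (balanceEq⇒2+r≤m (suc p) r (s≤s z≤n) 1≤r balance)

CR⇒neoPair : ∀ r x → x * x ≡ 2 * r * r + 5 * r + 2 → ∃ λ j → neoR j ≡ r × neoCR j ≡ x
CR⇒neoPair r x cr = j , r≡ , ,-injectiveʳ same
  where
  found = pell-complete (4 * r + 5 , x) (to (CR⇔pell r x) cr)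
  k = proj₁ found
  pk≡ : pell k ≡ (4 * r + 5 , x)
  pk≡ = proj₂ found
  odd = pell-y≡1mod4⇒odd k (trans (cong (_% 4) (,-injectiveˡ pk≡)) (4r+5≡1mod4 r))
  j = proj₁ odd
  same : (4 * neoR j + 5 , neoCR j) ≡ (4 * r + 5 , x)
  same = trans (sym (pell-odd j)) (trans (cong pell (sym (proj₂ odd))) pk≡)
  r≡ : neoR j ≡ r
  r≡ = *-cancelˡ-≡ (neoR j) r 4 (+-cancelʳ-≡ 5 (4 * neoR j) (4 * r) (,-injectiveˡ same))

neoBalcobalancing⇒neoB : ∀ m → IsNeoBalcobalancing m → ∃ λ j → m ≡ neoB j
neoBalcobalancing⇒neoB m (r , neo) = case neoBalcobalancer⇒CR neo of λ where
  (x , m≡ , cr) → case CR⇒neoPair r x cr of λ where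
    (j , r≡ , x≡) → j , trans (sym m≡) (sym (cong₂ (λ r x → 2 + r + x) r≡ x≡))

neo-balancing : ∀ j →
  neoCR j ≡ 3 * B (suc (2 * j)) × 4 * neoR j + 5 + 3 * B (2 * j) ≡ 9 * B (suc (2 * j))
neo-balancing j =
  trans (,-injectiveʳ (sym (pell-odd j))) (proj₂ (pell-balancing (2 * j))) ,
  trans (cong (_+ 3 * B (2 * j)) (,-injectiveˡ (sym (pell-odd j)))) (proj₁ (pell-balancing (2 * j)))

ClosedForms : (m r a b : ℕ) → Set
ClosedForms m r a b =
    4 * m + 3 * b ≡ 21 * a + 3
  × 4 * r + 3 * b + 5 ≡ 9 * a
  × 3 * b ≤ 15 * a
  × (15 * a ∸ 3 * b) * (15 * a ∸ 3 * b) + 12 * m ≡ 8 * m * m + 9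
  × (3 * a) * (3 * a) ≡ 2 * r * r + 5 * r + 2

closedForms : ∀ r x a b → BalanceEq (2 + r + x) r → x ≡ 3 * a → 4 * r + 5 + 3 * b ≡ 9 * a →
  ClosedForms (2 + r + x) r a b
closedForms r _ a b balance refl r-eq =
  m-eq , trans (identityʳ r b) r-eq , subst (3 * b ≤_) c-eq (m≤n+m (3 * b) c) ,
  subst (λ t → t * t + 12 * m ≡ 8 * m * m + 9) (sym 15a∸3b≡c) (balanceEq⇒lucas m r balance) ,
  to (balanceEq⇔CR r (3 * a)) balance
  where
  m = 2 + r + 3 * a
  c = 2 * m + 2 * r + 1
  identityʳ : ∀ r b → 4 * r + 3 * b + 5 ≡ 4 * r + 5 + 3 * b
  identityʳ = solve-∀
  identityᵐ : ∀ r a b → 4 * (2 + r + 3 * a) + 3 * b + 9 * a ≡ 21 * a + 3 + (4 * r + 5 + 3 * b)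
  identityᵐ = solve-∀
  identityᶜ : ∀ r a b → 2 * (2 + r + 3 * a) + 2 * r + 1 + 3 * b + 9 * a
                      ≡ 15 * a + (4 * r + 5 + 3 * b)
  identityᶜ = solve-∀
  m-eq : 4 * m + 3 * b ≡ 21 * a + 3
  m-eq = cancelʳ-by (identityᵐ r a b) (sym r-eq)
  c-eq : c + 3 * b ≡ 15 * a
  c-eq = cancelʳ-by (identityᶜ r a b) (sym r-eq)
  15a∸3b≡c : 15 * a ∸ 3 * b ≡ c
  15a∸3b≡c = trans (cong (_∸ 3 * b) (sym c-eq)) (m+n∸n≡m c (3 * b))

theorem2p2 : ∀ n → 1 ≤ n →
    Σ ℕ λ m → Σ ℕ λ r →
      NthNeoBalcobalancing n m × NeoBalcobalancer m r
      × 4 * m + 3 * B (2 * n ∸ 2) ≡ 21 * B (2 * n ∸ 1) + 3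
      × 4 * r + 3 * B (2 * n ∸ 2) + 5 ≡ 9 * B (2 * n ∸ 1)
      × 3 * B (2 * n ∸ 2) ≤ 15 * B (2 * n ∸ 1)
      × (15 * B (2 * n ∸ 1) ∸ 3 * B (2 * n ∸ 2)) * (15 * B (2 * n ∸ 1) ∸ 3 * B (2 * n ∸ 2)) + 12 * m ≡ 8 * m * m + 9
      × (3 * B (2 * n ∸ 1)) * (3 * B (2 * n ∸ 1)) ≡ 2 * r * r + 5 * r + 2
theorem2p2 zero ()
theorem2p2 (suc j) _ =
  neoB j , neoR j ,
  nthElem-enumeration neoB neoB-increasing (λ i → neoR i , neoB-neoBalcobalancer i)
    neoBalcobalancing⇒neoB j ,
  neoB-neoBalcobalancer j ,
  subst₂ (ClosedForms (neoB j) (neoR j))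
    (cong (λ t → B (t ∸ 1)) (sym (*-suc 2 j))) (cong (λ t → B (t ∸ 2)) (sym (*-suc 2 j)))
    (closedForms (neoR j) (neoCR j) (B (suc (2 * j))) (B (2 * j))
      (neoB-balanceEq j) (proj₁ (neo-balancing j)) (proj₂ (neo-balancing j)))
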